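{- Let $k\ge 2$ and $n\ge 2$ be integers. Then $\chi_\rho^{1,n}(S^k)=4$ if $k\ge 3$ and $n=2$, and $\chi_\rho^{1,n}(S^k)=3$ otherwise.
   Context: All graphs are finite and simple; $d_G(u,v)$ denotes the length of a shortest $u,v$-path in $G$. A $k$-coloring of $G$ is a map $f:V(G)\to\{1,\dots,k\}$. For integers $d,n\ge1$, set $s_i=d+\lfloor (i-1)/n\rfloor$. A $(d,n)$-packing $k$-coloring of $G$ is a $k$-coloring such that any two distinct vertices $u,v$ with the same color $i$ satisfy $d_G(u,v)>s_i$. The $(d,n)$-packing chromatic number $\chi_\rho^{d,n}(G)$ is the smallest $k$ for which $G$ admits a $(d,n)$-packing $k$-coloring. Base-3 Sierpiński graphs: $S^0=K_1$; for $k\ge1$, $V(S^k)=\{0,1,2\}^k$ (words of length $k$), and $E(S^k)=\{\{is,it\}: i\in\{0,1,2\},\ \{s,t\}\in E(S^{k-1})\}\cup\{\{ij^{k-1},ji^{k-1}\}: i,j\in\{0,1,2\},\ i\ne j\}$, where $ij^{k-1}$ denotes the word $i$ followed by $k-1$ copies of $j$. -}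

module Defs where

open import Data.Nat using (ℕ; zero; suc; _+_; _≤_; NonZero)
open import Data.Nat.DivMod using (_/_)
open import Data.Fin using (Fin; toℕ)
open import Data.Vec using (Vec; []; _∷_; replicate)
open import Data.Product using (Σ; _×_)
open import Relation.Binary.PropositionalEquality using (_≡_; _≢_)
open import Relation.Nullary using (¬_)

-- Vertices of the base-3 Sierpinski graph S^k: words of length k over {0,1,2}.
V : ℕ → Set
V k = Vec (Fin 3) k

data Adj : (k : ℕ) → V k → V k → Set where
  adj-cons   : ∀ {k} (i : Fin 3) {s t : V k} →
               Adj k s t → Adj (suc k) (i ∷ s) (i ∷ t)
  adj-bridge : ∀ {k} (i j : Fin 3) → i ≢ j →
               Adj (suc k) (i ∷ replicate k j) (j ∷ replicate k i)

data Walk (k : ℕ) : ℕ → V k → V k → Set where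
  nil  : ∀ {u} → Walk k 0 u u
  step : ∀ {m u w v} → Adj k u w → Walk k m w v → Walk k (suc m) u v

-- d_{S^k}(u,v) > s  ⇔  there is no u,v-walk of length ≤ s.
DistGt : (k : ℕ) → V k → V k → ℕ → Set
DistGt k u v s = ∀ m → m ≤ s → ¬ Walk k m u v

-- s_i = d + ⌊(i-1)/n⌋ for colour i ∈ {1..c}; colour i is represented by
-- the element i-1 of Fin c.
sBound : (d n : ℕ) → .{{_ : NonZero n}} → ℕ → ℕ
sBound d n j = d + j / n

IsPackingColoring : (d n : ℕ) → .{{_ : NonZero n}} → (k c : ℕ) → (V k → Fin c) → Set
IsPackingColoring d n k c f =
  ∀ (u v : V k) → u ≢ v → f u ≡ f v → DistGt k u v (sBound d n (toℕ (f u)))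

HasPackingColoring : (d n : ℕ) → .{{_ : NonZero n}} → (k c : ℕ) → Set
HasPackingColoring d n k c = Σ (V k → Fin c) (IsPackingColoring d n k c)

PackingChromaticNumberIs : (d n : ℕ) → .{{_ : NonZero n}} → (k c : ℕ) → Set
PackingChromaticNumberIs d n k c =
  HasPackingColoring d n k c × (∀ c' → suc c' ≤ c → ¬ HasPackingColoring d n k c')

module Submission where

-- With d = 1 the colour j (0-based) has packing radius 1 + ⌊j/n⌋.  Every
-- colouring used below has radii at most 2, so it is a packing as soon as it
-- is proper and no two distinct vertices of a radius-2 colour are joined by a
-- walk of length 2 (radius-two-packing).
--
-- A packing colouring of S^K restricts to every copy i S^(K-1),
-- so it suffices to refute colourings of S^1 (a triangle: three colours are
-- needed) and, for n = 2, three-colourings of S^3.  In a (1,2)-packing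
-- 3-colouring of S^2 every triangle a∗ contains the radius-2 colour, and only
-- at its corner aa; in S^3 the corners 011 and 100 are then adjacent.
--
-- A word is read letter by letter, recording how it ends (its
-- last letter, the letter before the final run, whether the final run is
-- doubled).  The last letter is a proper 3-colouring, a packing when n ≥ 3.
-- For n = 2 the single-run vertices get colours 0/1 by the cyclic orientation
-- of their last two distinct letters, the doubled ones colours 2/3 by the
-- linear order; doubled vertices are never at distance 2.  On S^2 the colour
-- 3 is unused, which gives the three-colouring there.

open import Defs
open import Data.Nat using (ℕ; zero; suc; _≤_; _≤′_; ≤′-refl; ≤′-step; _<ᵇ_; z≤n; s≤s; NonZero)
open import Data.Nat.Properties using (≤-trans; ≤-pred; <-irrefl; <-≤-trans; n<1+n; ≤⇒≤′)
open import Data.Nat.DivMod using (m<n⇒m/n≡0)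
open import Data.Fin using (Fin; zero; suc; toℕ; inject≤; lower₁; punchOut; _≟_; _≤?_)
open import Data.Fin.Properties
  using (toℕ<n; toℕ-inject≤; inject≤-injective; toℕ-lower₁; lower₁-injective;
         punchOut-injective; pigeonhole; any?; all?; ≤-antisym; ≤-total)
  renaming (<⇒≢ to <⇒≢ᶠ)
open import Data.Vec using ([]; _∷_; replicate; head; tail)
open import Data.Bool using (Bool; true; false)
import Data.Bool.Properties as Bool
open import Data.Product using (_×_; _,_; ∃; proj₁; proj₂)
open import Data.Sum using ([_,_]′)
open import Data.Empty using (⊥; ⊥-elim)
open import Function using (_∘_)
open import Relation.Nullary using (¬_; Dec; yes; no; does; contradiction)
open import Relation.Nullary.Decidable using (toWitness; ¬?; _→-dec_)
open import Relation.Binary.PropositionalEquality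
  using (_≡_; _≢_; refl; sym; trans; cong; subst; ≢-sym; module ≡-Reasoning)

open ≡-Reasoning

Letter : Set
Letter = Fin 3

-- An injection of Fin n into itself is onto: if y were missed, the values
-- would fit into Fin n ∖ {y} ≅ Fin (n - 1), contradicting the pigeonhole principle.
injection-onto : ∀ {n} (h : Fin n → Fin n) → (∀ {x y} → x ≢ y → h x ≢ h y) →
                 ∀ y → ∃ λ x → h x ≡ y
injection-onto {suc n} h separates y with any? (λ x → h x ≟ y)
... | yes hit  = hit
... | no  miss =
  let (x , x′ , x<x′ , same) = pigeonhole (n<1+n n) (λ x → punchOut (avoids x))
  in  ⊥-elim (separates (<⇒≢ᶠ x<x′) (punchOut-injective (avoids x) (avoids x′) same))
  where
  avoids : ∀ x → y ≢ h x
  avoids x y≡hx = miss (x , sym y≡hx)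

adj-sym : ∀ {k u v} → Adj k u v → Adj k v u
adj-sym (adj-cons i u~v)     = adj-cons i (adj-sym u~v)
adj-sym (adj-bridge i j i≢j) = adj-bridge j i (≢-sym i≢j)

adj-irreflexive : ∀ {k u v} → Adj k u v → u ≢ v
adj-irreflexive (adj-cons i u~v)     u≡v = adj-irreflexive u~v (cong tail u≡v)
adj-irreflexive (adj-bridge i j i≢j) u≡v = i≢j (cong head u≡v)

walk-in-copy : ∀ {k m u v} (i : Letter) → Walk k m u v → Walk (suc k) m (i ∷ u) (i ∷ v)
walk-in-copy i nil             = nil
walk-in-copy i (step u~w walk) = step (adj-cons i u~w) (walk-in-copy i walk)

Proper : (k : ℕ) {c : ℕ} → (V k → Fin c) → Set
Proper k f = ∀ {u v} → Adj k u v → f u ≢ f v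

radius : (n : ℕ) .{{_ : NonZero n}} {c : ℕ} → Fin c → ℕ
radius n j = sBound 1 n (toℕ j)

-- Every radius is at least 1, so a packing colouring is proper.
packing⇒proper : ∀ {d n} .{{_ : NonZero n}} {k c} {f : V k → Fin c} →
                 IsPackingColoring (suc d) n k c f → Proper k f
packing⇒proper pk u~v same = pk _ _ (adj-irreflexive u~v) same 1 (s≤s z≤n) (step u~v nil)

radius-two-packing :
  ∀ {n} .{{_ : NonZero n}} {k c} (f : V k → Fin c) →
  (∀ (j : Fin c) → radius n j ≤ 2) → Proper k f →
  (∀ {u w v} → u ≢ v → f u ≡ f v → 2 ≤ radius n (f u) → Adj k u w → Adj k w v → ⊥) →
  IsPackingColoring 1 n k c f
radius-two-packing {n} {k} f small proper apart u v u≢v same _ m≤r walk = excluded walk m≤r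
  where
  excluded : ∀ {m} → Walk k m u v → m ≤ radius n (f u) → ⊥
  excluded nil                          _   = u≢v refl
  excluded (step u~v nil)               _   = proper u~v same
  excluded (step u~w (step w~v nil))    2≤r = apart u≢v same 2≤r u~w w~v
  excluded (step _ (step _ (step _ _))) 3≤r =
    contradiction (≤-trans 3≤r (small (f u))) λ { (s≤s (s≤s ())) }

restrict-to-copy : ∀ {d n} .{{_ : NonZero n}} {k c} {f : V (suc k) → Fin c} (i : Letter) →
                   IsPackingColoring d n (suc k) c f →
                   IsPackingColoring d n k c (λ s → f (i ∷ s))
restrict-to-copy i pk u v u≢v same m m≤s walk =
  pk (i ∷ u) (i ∷ v) (u≢v ∘ cong tail) same m m≤s (walk-in-copy i walk)

restrict : ∀ {d n} .{{_ : NonZero n}} {k K c} → k ≤ K →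
           HasPackingColoring d n K c → HasPackingColoring d n k c
restrict {d} {n} {k} {K} {c} k≤K = go (≤⇒≤′ k≤K)
  where
  go : ∀ {K} → k ≤′ K → HasPackingColoring d n K c → HasPackingColoring d n k c
  go ≤′-refl        coloured = coloured
  go (≤′-step k≤′K) (f , pk) = go k≤′K ((λ s → f (zero ∷ s)) , restrict-to-copy zero pk)

more-colours : ∀ {d n} .{{_ : NonZero n}} {k c c′} → c ≤ c′ →
               HasPackingColoring d n k c → HasPackingColoring d n k c′
more-colours {d} {n} {k} {c} {c′} c≤c′ (f , pk) = f′ , pk′
  where
  f′ : V k → Fin c′
  f′ u = inject≤ (f u) c≤c′
  pk′ : IsPackingColoring d n k c′ f′
  pk′ u v u≢v same =
    subst (λ r → DistGt k u v (sBound d n r)) (sym (toℕ-inject≤ (f u) c≤c′))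
      (pk u v u≢v (inject≤-injective c≤c′ c≤c′ (f u) (f v) same))

drop-unused-colour : ∀ {d n} .{{_ : NonZero n}} {k c} (f : V k → Fin (suc c)) →
                     IsPackingColoring d n k (suc c) f → (∀ u → c ≢ toℕ (f u)) →
                     HasPackingColoring d n k c
drop-unused-colour {d} {n} {k} {c} f pk unused = f′ , pk′
  where
  f′ : V k → Fin c
  f′ u = lower₁ (f u) (unused u)
  pk′ : IsPackingColoring d n k c f′
  pk′ u v u≢v same =
    subst (λ r → DistGt k u v (sBound d n r)) (sym (toℕ-lower₁ (f u) (unused u)))
      (pk u v u≢v (lower₁-injective same))

-- By monotonicity in the number of colours, the chromatic number is c + 1 as
-- soon as c + 1 colours suffice and c do not.
chromatic-number : ∀ {d n} .{{_ : NonZero n}} {k c} →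
                   HasPackingColoring d n k (suc c) → ¬ HasPackingColoring d n k c →
                   PackingChromaticNumberIs d n k (suc c)
chromatic-number coloured impossible =
  coloured , λ c′ c′<1+c coloured′ → impossible (more-colours (≤-pred c′<1+c) coloured′)

-- S^1 is a triangle, so two colours cannot even be proper (pigeonhole).
no-2-colouring-of-S¹ : ∀ {d n} .{{_ : NonZero n}} → ¬ HasPackingColoring (suc d) n 1 2
no-2-colouring-of-S¹ (f , pk) =
  let (i , j , i<j , same) = pigeonhole (n<1+n 2) (λ x → f (x ∷ []))
  in  packing⇒proper pk (adj-bridge i j (<⇒≢ᶠ i<j)) same

triangle-bound : ∀ {d n} .{{_ : NonZero n}} {k} → 1 ≤ k → ¬ HasPackingColoring (suc d) n k 2
triangle-bound 1≤k = no-2-colouring-of-S¹ ∘ restrict 1≤k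

-- The colour of radius 2 among three colours when n = 2.
top : Fin 3
top = suc (suc zero)

module ThreeColouringOfS² (g : V 2 → Fin 3) (pk : IsPackingColoring 1 2 2 3 g) where

  proper : Proper 2 g
  proper = packing⇒proper pk

  -- The triangle a∗ is properly coloured with three colours, so it meets top.
  triangle-meets-top : ∀ a → ∃ λ b → g (a ∷ b ∷ []) ≡ top
  triangle-meets-top a =
    injection-onto (λ b → g (a ∷ b ∷ [])) (λ b≢b′ → proper (adj-cons a (adj-bridge _ _ b≢b′))) top

  -- A vertex ab with a ≢ b is adjacent to ba, so it lies within distance 2
  -- of the whole triangle b∗; as that triangle meets top, ab is not top.
  top-only-at-corners : ∀ {a b} → g (a ∷ b ∷ []) ≡ top → a ≡ b
  top-only-at-corners {a} {b} ab-top with a ≟ b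
  ... | yes a≡b = a≡b
  ... | no  a≢b with triangle-meets-top b
  ...   | c , bc-top with c ≟ a
  ...     | yes refl = ⊥-elim (proper (adj-bridge a b a≢b) (trans ab-top (sym bc-top)))
  ...     | no  c≢a  = ⊥-elim (pk (a ∷ b ∷ []) (b ∷ c ∷ []) (a≢b ∘ cong head)
                          (trans ab-top (sym bc-top)) 2 radius≥2
                          (step (adj-bridge a b a≢b) (step (adj-cons b (adj-bridge a c (≢-sym c≢a))) nil)))
    where
    radius≥2 : 2 ≤ radius 2 (g (a ∷ b ∷ []))
    radius≥2 = subst (λ j → 2 ≤ radius 2 j) (sym ab-top) (s≤s (s≤s z≤n))

  corner-is-top : ∀ a → g (a ∷ a ∷ []) ≡ top
  corner-is-top a with triangle-meets-top a
  ... | b , ab-top with top-only-at-corners ab-top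
  ...   | refl = ab-top

-- In S^3 the corners 011 and 100 of the copies 0 S^2 and 1 S^2 are adjacent,
-- yet both would have to be top.
no-3-colouring-of-S³ : ¬ HasPackingColoring 1 2 3 3
no-3-colouring-of-S³ (f , pk) =
  packing⇒proper pk (adj-bridge zero (suc zero) (λ ()))
    (trans (corner-in-copy zero (suc zero)) (sym (corner-in-copy (suc zero) zero)))
  where
  corner-in-copy : ∀ i a → f (i ∷ a ∷ a ∷ []) ≡ top
  corner-in-copy i a = ThreeColouringOfS².corner-is-top (λ s → f (i ∷ s)) (restrict-to-copy i pk) a

three-colour-bound : ∀ {k} → 3 ≤ k → ¬ HasPackingColoring 1 2 k 3
three-colour-bound 3≤k = no-3-colouring-of-S³ ∘ restrict 3≤k

-- How a word ends: its last letter, the letter before its final run, and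
-- whether the final run has length at least 2.  Words are read letter by letter.
record Ending : Set where
  constructor ending
  field
    before  : Letter
    last    : Letter
    doubled : Bool
open Ending

extend : Ending → Letter → Ending
extend (ending p c b) i with i ≟ c
... | yes _ = ending p c true
... | no  _ = ending c i false

read : ∀ {k} → Ending → V k → Ending
read σ []      = σ
read σ (i ∷ s) = read (extend σ i) s

extend-repeat : ∀ p c b → extend (ending p c b) c ≡ ending p c true
extend-repeat p c b with c ≟ c
... | yes _   = refl
... | no  c≢c = ⊥-elim (c≢c refl)

extend-new : ∀ σ {i} → i ≢ last σ → extend σ i ≡ ending (last σ) i false
extend-new (ending p c b) {i} i≢c with i ≟ c
... | yes i≡c = ⊥-elim (i≢c i≡c)
... | no  _   = refl

extend-last : ∀ σ i → last (extend σ i) ≡ i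
extend-last (ending p c b) i with i ≟ c
... | yes i≡c = sym i≡c
... | no  _   = refl

extend-doubled : ∀ σ {i} → doubled (extend σ i) ≡ true → i ≡ last σ
extend-doubled (ending p c b) {i} isDoubled with i ≟ c
... | yes i≡c = i≡c
... | no  _   = contradiction isDoubled λ ()

extend-twice : ∀ σ {i j} → i ≢ j → extend (extend σ i) j ≡ ending i j false
extend-twice σ {i} {j} i≢j = begin
  extend (extend σ i) j               ≡⟨ extend-new (extend σ i) j≢last ⟩
  ending (last (extend σ i)) j false ≡⟨ cong (λ p → ending p j false) (extend-last σ i) ⟩
  ending i j false                    ∎
  where
  j≢last : j ≢ last (extend σ i)
  j≢last j≡last = i≢j (sym (trans j≡last (extend-last σ i)))

read-repeats : ∀ k p c → read (ending p c true) (replicate k c) ≡ ending p c true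
read-repeats zero    p c = refl
read-repeats (suc k) p c = begin
  read (extend (ending p c true) c) (replicate k c) ≡⟨ cong (λ τ → read τ (replicate k c)) (extend-repeat p c true) ⟩
  read (ending p c true) (replicate k c)            ≡⟨ read-repeats k p c ⟩
  ending p c true                                   ∎

read-switch : ∀ σ {i j} k → i ≢ j → read σ (i ∷ replicate (suc k) j) ≡ ending i j (0 <ᵇ k)
read-switch σ zero    i≢j = extend-twice σ i≢j
read-switch σ {i} {j} (suc k) i≢j = begin
  read (extend (extend σ i) j) (j ∷ replicate k j) ≡⟨ cong (λ τ → read τ (j ∷ replicate k j)) (extend-twice σ i≢j) ⟩
  read (extend (ending i j false) j) (replicate k j) ≡⟨ cong (λ τ → read τ (replicate k j)) (extend-repeat i j false) ⟩
  read (ending i j true) (replicate k j)            ≡⟨ read-repeats k i j ⟩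
  ending i j true                                   ∎

next : Letter → Letter
next zero             = suc zero
next (suc zero)       = suc (suc zero)
next (suc (suc zero)) = zero

clockwise : Letter → Letter → Bool
clockwise p c = does (c ≟ next p)

clockwise-split : ∀ c i j → c ≢ i → c ≢ j → i ≢ j → clockwise c i ≢ clockwise c j
clockwise-split = toWitness {a? = all? λ c → all? λ i → all? λ j →
  ¬? (c ≟ i) →-dec ¬? (c ≟ j) →-dec ¬? (i ≟ j) →-dec ¬? (clockwise c i Bool.≟ clockwise c j)} _

clockwise-antisym : ∀ p c → p ≢ c → clockwise p c ≢ clockwise c p
clockwise-antisym = toWitness {a? = all? λ p → all? λ c →
  ¬? (p ≟ c) →-dec ¬? (clockwise p c Bool.≟ clockwise c p)} _

decisions-differ : ∀ {A B : Set} (a? : Dec A) (b? : Dec B) →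
                   (A → B → ⊥) → (¬ A → ¬ B → ⊥) → does a? ≢ does b?
decisions-differ (yes a) (yes b) exclusive _ _ = exclusive a b
decisions-differ (no ¬a) (no ¬b) _ exhaustive _ = exhaustive ¬a ¬b
decisions-differ (yes _) (no _)  _ _ ()
decisions-differ (no _)  (yes _) _ _ ()

ascending-antisym : ∀ {n} {p c : Fin n} → p ≢ c → does (p ≤? c) ≢ does (c ≤? p)
ascending-antisym {p = p} {c} p≢c =
  decisions-differ (p ≤? c) (c ≤? p) (λ p≤c c≤p → p≢c (≤-antisym p≤c c≤p))
    (λ p≰c c≰p → [ p≰c , c≰p ]′ (≤-total p c))

orientation : Bool → Letter → Letter → Bool
orientation false p c = clockwise p c
orientation true  p c = does (p ≤? c)

orientation-antisym : ∀ b {p c} → p ≢ c → orientation b p c ≢ orientation b c p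
orientation-antisym false = clockwise-antisym _ _
orientation-antisym true  = ascending-antisym

code : Bool → Bool → Fin 4
code false true  = zero
code false false = suc zero
code true  true  = suc (suc zero)
code true  false = suc (suc (suc zero))

decode : Fin 4 → Bool × Bool
decode zero                   = false , true
decode (suc zero)             = false , false
decode (suc (suc zero))       = true  , true
decode (suc (suc (suc zero))) = true  , false

decode-code : ∀ b o → decode (code b o) ≡ (b , o)
decode-code false true  = refl
decode-code false false = refl
decode-code true  true  = refl
decode-code true  false = refl

code-injective : ∀ {b o b′ o′} → code b o ≡ code b′ o′ → (b , o) ≡ (b′ , o′)
code-injective {b} {o} {b′} {o′} same = begin
  (b , o)              ≡⟨ sym (decode-code b o) ⟩
  decode (code b o)    ≡⟨ cong decode same ⟩
  decode (code b′ o′)  ≡⟨ decode-code b′ o′ ⟩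
  (b′ , o′)            ∎

radius₄≤2 : ∀ (j : Fin 4) → radius 2 j ≤ 2
radius₄≤2 zero                   = s≤s z≤n
radius₄≤2 (suc zero)             = s≤s z≤n
radius₄≤2 (suc (suc zero))       = s≤s (s≤s z≤n)
radius₄≤2 (suc (suc (suc zero))) = s≤s (s≤s z≤n)

radius-2-doubled : ∀ b o → 2 ≤ radius 2 (code b o) → b ≡ true
radius-2-doubled false true  (s≤s ())
radius-2-doubled false false (s≤s ())
radius-2-doubled true  _     _ = refl

paint : Ending → Fin 4
paint τ = code (doubled τ) (orientation (doubled τ) (before τ) (last τ))

paint-flags : ∀ {τ τ′} → doubled τ ≢ doubled τ′ → paint τ ≢ paint τ′
paint-flags flags-differ same = flags-differ (cong proj₁ (code-injective same))

paint-orientations : ∀ {b p c p′ c′} → orientation b p c ≢ orientation b p′ c′ →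
                     paint (ending p c b) ≢ paint (ending p′ c′ b)
paint-orientations orientations-differ same = orientations-differ (cong proj₂ (code-injective same))

-- The one-letter words i ≢ j read from any state get different colours:
-- if one of them repeats the last letter it is doubled and the other is not;
-- otherwise both are single runs after that letter, oriented differently.
first-letters-differ : ∀ σ {i j} → i ≢ j → paint (extend σ i) ≢ paint (extend σ j)
first-letters-differ (ending p c b) {i} {j} i≢j with i ≟ c | j ≟ c
... | yes i≡c | yes j≡c = ⊥-elim (i≢j (trans i≡c (sym j≡c)))
... | yes _   | no  _   = paint-flags {ending p c true} {ending c j false} λ ()
... | no  _   | yes _   = paint-flags {ending c i false} {ending p c true} λ ()
... | no  i≢c | no  j≢c =
  paint-orientations {false} {c} {i} {c} {j} (clockwise-split c i j (≢-sym i≢c) (≢-sym j≢c) i≢j)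

-- Reading from any state, adjacent vertices get different colours: inside a
-- copy the common prefix is read first; the bridge i j^(k+1) ~ j i^(k+1)
-- joins two endings (i, j) and (j, i) with the same flag.
paint-proper : ∀ {k} σ → Proper k (λ u → paint (read σ u))
paint-proper σ (adj-cons i u~v)            = paint-proper (extend σ i) u~v
paint-proper σ (adj-bridge {zero} i j i≢j) = first-letters-differ σ i≢j
paint-proper σ (adj-bridge {suc k} i j i≢j)
  rewrite read-switch σ k i≢j | read-switch σ k (≢-sym i≢j) =
  paint-orientations (orientation-antisym (0 <ᵇ k) i≢j)

beside-extreme-single : ∀ σ {k} j {u} → Adj (suc (suc k)) u (replicate (suc (suc k)) j) →
                        doubled (read σ u) ≡ false
beside-extreme-single σ {zero}  j (adj-cons .j (adj-bridge x .j x≢j)) =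
  cong doubled (extend-twice σ (≢-sym x≢j))
beside-extreme-single σ {suc k} j (adj-cons .j u~jj) = beside-extreme-single (extend σ j) j u~jj
beside-extreme-single σ         j (adj-bridge .j .j j≢j) = ⊥-elim (j≢j refl)

switch-single : ∀ σ {i j} → i ≢ j → doubled (read σ (i ∷ j ∷ [])) ≡ false
switch-single σ i≢j = cong doubled (extend-twice σ i≢j)

doubled-apart : ∀ {k} σ {u w v : V k} → u ≢ v → Adj k u w → Adj k w v →
                doubled (read σ u) ≡ true → doubled (read σ v) ≡ true → ⊥
doubled-apart σ u≢v (adj-cons i u~w) (adj-cons .i w~v) du dv =
  doubled-apart (extend σ i) (u≢v ∘ cong (i ∷_)) u~w w~v du dv
doubled-apart σ _ (adj-cons i _) (adj-bridge {suc zero} .i j i≢j) _ dv =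
  contradiction (trans (sym (switch-single σ (≢-sym i≢j))) dv) λ ()
doubled-apart σ _ (adj-cons i u~w) (adj-bridge {suc (suc k)} .i j _) du _ =
  contradiction (trans (sym (beside-extreme-single (extend σ i) j u~w)) du) λ ()
doubled-apart σ _ (adj-bridge {suc zero} i j i≢j) (adj-cons .j _) du _ =
  contradiction (trans (sym (switch-single σ i≢j)) du) λ ()
doubled-apart σ _ (adj-bridge {suc (suc k)} i j _) (adj-cons .j w~v) _ dv =
  contradiction (trans (sym (beside-extreme-single (extend σ j) i (adj-sym w~v))) dv) λ ()
doubled-apart σ u≢v (adj-bridge {zero} i j _) (adj-bridge {zero} .j l _) du dv =
  u≢v (cong (_∷ []) (trans (extend-doubled σ du) (sym (extend-doubled σ dv))))
doubled-apart σ u≢v (adj-bridge {suc k} i j _) (adj-bridge .j .i _) _ _ = u≢v refl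

-- Words are read from a doubled run of 0s preceded by 0; as 0 is the least
-- letter, the doubled vertices aa of S^2 then all get the ascending colour 2.
start : Ending
start = ending zero zero true

lastLetter : ∀ {k} → V k → Fin 3
lastLetter u = last (read start u)

last-proper : ∀ {k} σ → Proper k (λ u → last (read σ u))
last-proper σ (adj-cons i u~v) = last-proper (extend σ i) u~v
last-proper σ (adj-bridge {zero} i j i≢j)
  rewrite extend-last σ i | extend-last σ j = i≢j
last-proper σ (adj-bridge {suc k} i j i≢j)
  rewrite read-switch σ k i≢j | read-switch σ k (≢-sym i≢j) = ≢-sym i≢j

radius-one : ∀ {n} .{{_ : NonZero n}} {c} → c ≤ n → (j : Fin c) → radius n j ≡ 1
radius-one c≤n j = cong suc (m<n⇒m/n≡0 (<-≤-trans (toℕ<n j) c≤n))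

lastLetter-packing : ∀ {n} .{{_ : NonZero n}} → 3 ≤ n → ∀ k →
                     IsPackingColoring 1 n k 3 lastLetter
lastLetter-packing 3≤n k =
  radius-two-packing lastLetter (λ j → subst (_≤ 2) (sym (radius-one 3≤n j)) (s≤s z≤n))
    (last-proper start)
    (λ {u} _ _ 2≤r _ _ → <-irrefl refl (subst (2 ≤_) (radius-one 3≤n (lastLetter u)) 2≤r))

colour₄ : ∀ {k} → V k → Fin 4
colour₄ u = paint (read start u)

colour₄-packing : ∀ k → IsPackingColoring 1 2 k 4 colour₄
colour₄-packing k = radius-two-packing colour₄ radius₄≤2 (paint-proper start) apart
  where
  doubled-if-radius-2 : ∀ u → 2 ≤ radius 2 (colour₄ u) → doubled (read start u) ≡ true
  doubled-if-radius-2 u = radius-2-doubled _ _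
  apart : ∀ {u w v} → u ≢ v → colour₄ u ≡ colour₄ v → 2 ≤ radius 2 (colour₄ u) →
          Adj k u w → Adj k w v → ⊥
  apart {u} {v = v} u≢v same 2≤r u~w w~v =
    doubled-apart start u≢v u~w w~v (doubled-if-radius-2 u 2≤r)
      (doubled-if-radius-2 v (subst (λ j → 2 ≤ radius 2 j) same 2≤r))

colour₄-on-S²-avoids-3 : ∀ (u : V 2) → 3 ≢ toℕ (colour₄ u)
colour₄-on-S²-avoids-3 (zero ∷ zero ∷ [])                   ()
colour₄-on-S²-avoids-3 (zero ∷ suc zero ∷ [])               ()
colour₄-on-S²-avoids-3 (zero ∷ suc (suc zero) ∷ [])         ()
colour₄-on-S²-avoids-3 (suc zero ∷ zero ∷ [])               ()
colour₄-on-S²-avoids-3 (suc zero ∷ suc zero ∷ [])           ()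
colour₄-on-S²-avoids-3 (suc zero ∷ suc (suc zero) ∷ [])     ()
colour₄-on-S²-avoids-3 (suc (suc zero) ∷ zero ∷ [])         ()
colour₄-on-S²-avoids-3 (suc (suc zero) ∷ suc zero ∷ [])     ()
colour₄-on-S²-avoids-3 (suc (suc zero) ∷ suc (suc zero) ∷ []) ()

three-colouring-of-S² : HasPackingColoring 1 2 2 3
three-colouring-of-S² = drop-unused-colour colour₄ (colour₄-packing 2) colour₄-on-S²-avoids-3

exceptional-case : ∀ k n .{{_ : NonZero n}} → 3 ≤ k × n ≡ 2 → PackingChromaticNumberIs 1 n k 4
exceptional-case k .2 (3≤k , refl) =
  chromatic-number (colour₄ , colour₄-packing k) (three-colour-bound 3≤k)

generic-case : ∀ k n .{{_ : NonZero n}} → 2 ≤ k → 2 ≤ n → ¬ (3 ≤ k × n ≡ 2) →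
               PackingChromaticNumberIs 1 n k 3
generic-case k (suc (suc (suc n))) 2≤k _ _ =
  chromatic-number (lastLetter , lastLetter-packing (s≤s (s≤s (s≤s z≤n))) k)
    (triangle-bound (≤-trans (s≤s z≤n) 2≤k))
generic-case 2 2 _ _ _ = chromatic-number three-colouring-of-S² (triangle-bound (s≤s z≤n))
generic-case (suc (suc (suc k))) 2 _ _ not-exceptional =
  ⊥-elim (not-exceptional (s≤s (s≤s (s≤s z≤n)) , refl))
generic-case 1 2 (s≤s ()) _ _
generic-case _ 1 _ (s≤s ()) _

mainTheorem3 : ∀ (k n : ℕ) .{{_ : NonZero n}} → 2 ≤ k → 2 ≤ n →
    ((3 ≤ k × n ≡ 2) → PackingChromaticNumberIs 1 n k 4)
    × (¬ (3 ≤ k × n ≡ 2) → PackingChromaticNumberIs 1 n k 3)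
mainTheorem3 k n 2≤k 2≤n = exceptional-case k n , generic-case k n 2≤k 2≤n
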